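{- Let $p,q,s,t$ be positive integers with $p<s\le t$ and $s<q$, and let $\varepsilon>0$. Then for $n$ large enough the following holds. Let $G$ be an $n$-vertex graph containing no subgraph isomorphic to $K_{s,t}$, and let $U$ be the set of vertices of $G$ of degree at most $\varepsilon n$. Then the number of copies of $K_{p,q}$ in $G$ whose smaller part (the part of order $p$) contains a vertex of $U$ is at most $\varepsilon n^{p+q-1}$.
   Context: $K_{p,q}$ denotes the complete bipartite graph with parts of orders $p$ and $q$. A copy of a graph in $G$ means a subgraph of $G$ isomorphic to it.
   Formalization: The parameter ε ranges over the positive rationals, both in the degree threshold defining U and in the bound on the number of copies. -}

module Defs where

open import Data.Nat using (ℕ; zero; suc; _*_; _≤ᵇ_; _≡ᵇ_)
open import Data.Bool using (Bool; true; false; _∧_; _∨_; not)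
open import Data.Fin using (Fin)
open import Data.Vec using (Vec; []; _∷_; lookup; tabulate)
open import Data.List using (List; []; _∷_; _++_; map; length; filter; allFin; cartesianProduct)
open import Data.Bool.ListAction using (all; any)
open import Data.Fin.Subset using (Subset; ∣_∣)
open import Data.Product using (_×_; _,_)
open import Relation.Binary.PropositionalEquality using (_≡_)
open import Relation.Nullary.Decidable using (T?)

record Graph (n : ℕ) : Set where
  field
    adj    : Fin n → Fin n → Bool
    sym    : ∀ i j → adj i j ≡ adj j i
    irrefl : ∀ i → adj i i ≡ false
open Graph public

deg : ∀ {n} → Graph n → Fin n → ℕ
deg G i = ∣ tabulate (adj G i) ∣

allSubsets : ∀ n → List (Subset n)
allSubsets zero = [] ∷ []
allSubsets (suc n) = map (true ∷_) (allSubsets n) ++ map (false ∷_) (allSubsets n)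

-- (A , B) spans a copy of K_{p,q} in G with A the part of order p and
-- B the part of order q: A, B disjoint, |A| = p, |B| = q, and every
-- vertex of A is adjacent to every vertex of B.
-- (For p ≠ q, copies of K_{p,q} (as subgraphs) correspond bijectively
-- to such pairs.)
isKpq : ∀ {n} → Graph n → ℕ → ℕ → Subset n → Subset n → Bool
isKpq {n} G p q A B =
  (∣ A ∣ ≡ᵇ p) ∧ (∣ B ∣ ≡ᵇ q)
  ∧ all (λ i → not (lookup A i ∧ lookup B i)) (allFin n)
  ∧ all (λ i → all (λ j → not (lookup A i ∧ lookup B j) ∨ adj G i j) (allFin n)) (allFin n)

KstFree : ∀ {n} → Graph n → ℕ → ℕ → Set
KstFree {n} G s t = ∀ (A B : Subset n) → isKpq G s t A B ≡ false

-- the set A contains a vertex of degree at most ε·n, where ε = a / b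
meetsLowDeg : ∀ {n} → Graph n → ℕ → ℕ → Subset n → Bool
meetsLowDeg {n} G a b A = any (λ i → lookup A i ∧ (deg G i * b ≤ᵇ a * n)) (allFin n)

countLowCopies : ∀ {n} → Graph n → ℕ → ℕ → ℕ → ℕ → ℕ
countLowCopies {n} G p q a b =
  length (filter (λ AB → T? (goodPair AB)) (cartesianProduct (allSubsets n) (allSubsets n)))
  where
  goodPair : Subset n × Subset n → Bool
  goodPair (A , B) = isKpq G p q A B ∧ meetsLowDeg G a b A

-- Count a copy (A , B) of K_{p,q} through its part B of order q. Since q ≥ s and G is
-- K_{s,t}-free, B has fewer than t common neighbours, so there are at most C(t,p)·n^q copies;
-- for p ≥ 2 this is o(n^{p+q-1}).
--
-- For p = 1 a copy is a vertex u of degree at most εn (ε = a/b) together with a q-subset of its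
-- neighbourhood, so it suffices to bound the sum of C(d(u),q) over such u. Put M = 2tb.
-- Each s-set has fewer than t common neighbours, so Σ_u C(d(u),s) ≤ t·n^s; hence the vertices
-- with d(u)·M < n contribute at most n^{q-s}·Σ_u C(d(u),s)/M ≤ n^q/(2b).
-- Double counting the edges leaving a vertex set U gives the Kővári–Sós–Turán bound
-- Σ_{u∈U} d(u) ≤ (s-1)·n + t·C(|U|,s), using x ≤ (s-1) + C(x,s). Once n > t·C(sM,s) it forces
-- fewer than sM vertices with d(u)·M ≥ n, and then their degrees sum to at most s·n. Each of
-- them with d(u) ≤ εn contributes C(d,q) ≤ d^q/q! ≤ ε·n^{q-1}·d/q!, in total at most
-- ε·s·n^q/q! ≤ ε·n^q/2, because q! ≥ 2s when 2 ≤ s < q.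

module Submission where

open import Defs hiding (sym)

import Algebra.Properties.CommutativeSemigroup as CommSemigroupProperties
open import Data.Bool using (Bool; true; false; T; _∧_; _∨_; not)
open import Data.Bool.ListAction using (all)
open import Data.Bool.Properties using (T-≡; T-∧; ∧-zeroʳ)
open import Data.Empty using (⊥-elim)
open import Data.Fin as Fin using (Fin; zero; suc)
open import Data.Fin.Subset using (Subset; ∣_∣; inside; outside; _∈_; _⊆_; _⊂_; _∩_; ⊤; ⊥; ⁅_⁆)
open import Data.Fin.Subset.Properties
  using (_⊆?_; ⊆-min; ⊆⊤; in⊆in; out⊆; p∩q⊆p; p∩q⊆q; ∩-identityˡ; ∣⊥∣≡0; ∣⊤∣≡n; ∣p∣≤n; ∣⁅x⁆∣≡1;
         p⊆q⇒∣p∣≤∣q∣; p⊂q⇒∣p∣<∣q∣; x∈⁅y⁆⇒x≡y)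
open import Data.List using (List; []; _∷_; _++_; map; length; filter; allFin; cartesianProduct)
open import Data.List.Membership.Propositional.Properties using (∈-allFin)
open import Data.List.Properties using (map-cong; map-++; map-∘; map-tabulate; length-tabulate)
import Data.List.Relation.Unary.All as All
open import Data.List.Relation.Unary.All.Properties using (all⁺; all⁻)
import Data.List.Relation.Unary.Any as Any
open import Data.List.Relation.Unary.Any.Properties using (any⁻)
open import Data.Nat using (ℕ; zero; suc; _+_; _*_; _∸_; _^_; _!; _≤_; _<_; z≤n; s≤s; _≡ᵇ_; _≤ᵇ_; >-nonZero)
open import Data.Nat.Combinatorics using (_C_; nCk+nC[k+1]≡[n+1]C[k+1]; nC1≡n)
open import Data.Nat.ListAction using (sum)
open import Data.Nat.ListAction.Properties using (sum-++)
open import Data.Nat.Properties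
open import Data.Nat.Tactic.RingSolver using (solve-∀)
open import Data.Product using (_×_; _,_; proj₁; proj₂; ∃; ∃-syntax)
open import Data.Vec using ([]; _∷_; lookup; tabulate)
open import Data.Vec.Properties using (lookup∘tabulate; lookup-zipWith; []=⇒lookup; lookup⇒[]=)
open import Function using (_∘_; id)
open import Function.Bundles using (Equivalence)
open import Level using (Level)
open import Relation.Binary.PropositionalEquality
open import Relation.Nullary using (Dec; yes; no; does; ¬_)
open import Relation.Nullary.Decidable using (T?; dec-true)

module +-CS = CommSemigroupProperties +-commutativeSemigroup
module *-CS = CommSemigroupProperties *-commutativeSemigroup

𝟙 : Bool → ℕ
𝟙 true  = 1
𝟙 false = 0

𝟙-∧ : ∀ x y → 𝟙 (x ∧ y) ≡ 𝟙 x * 𝟙 y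
𝟙-∧ true  y = sym (+-identityʳ (𝟙 y))
𝟙-∧ false y = refl

𝟙-mono : ∀ {x y} → (T x → T y) → 𝟙 x ≤ 𝟙 y
𝟙-mono {false}         _   = z≤n
𝟙-mono {true}  {true}  _   = ≤-refl
𝟙-mono {true}  {false} x⇒y = ⊥-elim (x⇒y _)

𝟙*-mono : ∀ x {m n} → (T x → m ≤ n) → 𝟙 x * m ≤ 𝟙 x * n
𝟙*-mono false _   = z≤n
𝟙*-mono true  m≤n = +-monoˡ-≤ 0 (m≤n _)

𝟙*≤ : ∀ x {m n} → (T x → m ≤ n) → 𝟙 x * m ≤ n
𝟙*≤ false _   = z≤n
𝟙*≤ true  m≤n = ≤-trans (≤-reflexive (+-identityʳ _)) (m≤n _)

T-not⇒¬T : ∀ {x} → T (not x) → ¬ T x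
T-not⇒¬T {false} _ ()

private
  variable
    a b : Level
    A : Set a
    B : Set b

∑ : List A → (A → ℕ) → ℕ
∑ xs f = sum (map f xs)

infix 10 ∑
syntax ∑ xs (λ x → e) = ∑[ x ∈ xs ] e

∑-cong : ∀ xs {f g : A → ℕ} → (∀ x → f x ≡ g x) → ∑ xs f ≡ ∑ xs g
∑-cong xs f≗g = cong sum (map-cong f≗g xs)

∑-mono-≤ : ∀ xs {f g : A → ℕ} → (∀ x → f x ≤ g x) → ∑ xs f ≤ ∑ xs g
∑-mono-≤ []       _   = z≤n
∑-mono-≤ (x ∷ xs) f≤g = +-mono-≤ (f≤g x) (∑-mono-≤ xs f≤g)

∑-++ : ∀ xs ys (f : A → ℕ) → ∑ (xs ++ ys) f ≡ ∑ xs f + ∑ ys f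
∑-++ xs ys f = trans (cong sum (map-++ f xs ys)) (sum-++ (map f xs) (map f ys))

∑-map : ∀ (g : A → B) xs f → ∑ (map g xs) f ≡ ∑ xs (f ∘ g)
∑-map g xs f = cong sum (sym (map-∘ xs))

∑-const : ∀ (xs : List A) c → ∑[ x ∈ xs ] c ≡ length xs * c
∑-const []       c = refl
∑-const (x ∷ xs) c = cong (c +_) (∑-const xs c)

∑-zero : ∀ (xs : List A) → ∑[ x ∈ xs ] 0 ≡ 0
∑-zero xs = trans (∑-const xs 0) (*-zeroʳ (length xs))

*-distribˡ-∑ : ∀ c xs (f : A → ℕ) → c * ∑ xs f ≡ ∑[ x ∈ xs ] (c * f x)
*-distribˡ-∑ c []       f = *-zeroʳ c
*-distribˡ-∑ c (x ∷ xs) f =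
  trans (*-distribˡ-+ c (f x) (∑ xs f)) (cong (c * f x +_) (*-distribˡ-∑ c xs f))

∑-distrib-+ : ∀ xs (f g : A → ℕ) → ∑[ x ∈ xs ] (f x + g x) ≡ ∑ xs f + ∑ xs g
∑-distrib-+ []       f g = refl
∑-distrib-+ (x ∷ xs) f g =
  trans (cong (f x + g x +_) (∑-distrib-+ xs f g)) (+-CS.interchange (f x) (g x) (∑ xs f) (∑ xs g))

∑-comm : ∀ xs ys (f : A → B → ℕ) → ∑[ x ∈ xs ] ∑[ y ∈ ys ] f x y ≡ ∑[ y ∈ ys ] ∑[ x ∈ xs ] f x y
∑-comm []       ys f = sym (∑-zero ys)
∑-comm (x ∷ xs) ys f =
  trans (cong (∑ ys (f x) +_) (∑-comm xs ys f)) (sym (∑-distrib-+ ys (f x) λ y → ∑[ x ∈ xs ] f x y))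

∑-cartesianProduct : ∀ xs ys (f : A × B → ℕ) →
  ∑ (cartesianProduct xs ys) f ≡ ∑[ x ∈ xs ] ∑[ y ∈ ys ] f (x , y)
∑-cartesianProduct []       ys f = refl
∑-cartesianProduct (x ∷ xs) ys f = begin
  ∑ (map (x ,_) ys ++ cartesianProduct xs ys) f  ≡⟨ ∑-++ (map (x ,_) ys) _ f ⟩
  ∑ (map (x ,_) ys) f + ∑ (cartesianProduct xs ys) f
    ≡⟨ cong₂ _+_ (∑-map (x ,_) ys f) (∑-cartesianProduct xs ys f) ⟩
  ∑[ y ∈ ys ] f (x , y) + ∑[ x ∈ xs ] ∑[ y ∈ ys ] f (x , y) ∎
  where open ≡-Reasoning

length-filter≡∑𝟙 : ∀ (P : A → Bool) xs →
  length (filter (λ x → T? (P x)) xs) ≡ ∑[ x ∈ xs ] 𝟙 (P x)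
length-filter≡∑𝟙 P []       = refl
length-filter≡∑𝟙 P (x ∷ xs) with P x
... | true  = cong suc (length-filter≡∑𝟙 P xs)
... | false = length-filter≡∑𝟙 P xs

∑-allFin : ∀ {n} (f : Fin (suc n) → ℕ) → ∑ (allFin (suc n)) f ≡ f zero + ∑[ i ∈ allFin n ] f (suc i)
∑-allFin {n} f =
  cong (f zero +_) (trans (cong sum (map-tabulate suc f)) (sym (cong sum (map-tabulate id (f ∘ suc)))))

∣p∣≡∑𝟙 : ∀ {n} (p : Subset n) → ∣ p ∣ ≡ ∑[ i ∈ allFin n ] 𝟙 (lookup p i)
∣p∣≡∑𝟙 []            = refl
∣p∣≡∑𝟙 (inside  ∷ p) = trans (cong suc (∣p∣≡∑𝟙 p)) (sym (∑-allFin (𝟙 ∘ lookup (inside ∷ p))))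
∣p∣≡∑𝟙 (outside ∷ p) = trans (∣p∣≡∑𝟙 p) (sym (∑-allFin (𝟙 ∘ lookup (outside ∷ p))))

module _ {n : ℕ} where

  T-lookup⇒∈ : ∀ {p : Subset n} {i} → T (lookup p i) → i ∈ p
  T-lookup⇒∈ {p} {i} pᵢ = lookup⇒[]= i p (Equivalence.to T-≡ pᵢ)

  ∈⇒T-lookup : ∀ {p : Subset n} {i} → i ∈ p → T (lookup p i)
  ∈⇒T-lookup i∈p = Equivalence.from T-≡ ([]=⇒lookup i∈p)

  ∈-tabulate⁺ : ∀ {f : Fin n → Bool} {i} → T (f i) → i ∈ tabulate f
  ∈-tabulate⁺ {f} {i} = T-lookup⇒∈ ∘ subst T (sym (lookup∘tabulate f i))

  ∈-tabulate⁻ : ∀ {f : Fin n → Bool} {i} → i ∈ tabulate f → T (f i)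
  ∈-tabulate⁻ {f} {i} = subst T (lookup∘tabulate f i) ∘ ∈⇒T-lookup

  ∣tabulate∣≡∑𝟙 : ∀ (f : Fin n → Bool) → ∣ tabulate f ∣ ≡ ∑[ i ∈ allFin n ] 𝟙 (f i)
  ∣tabulate∣≡∑𝟙 f = trans (∣p∣≡∑𝟙 (tabulate f)) (∑-cong (allFin n) (cong 𝟙 ∘ lookup∘tabulate f))

⊆-ofSize : ∀ {n} (p : Subset n) {k} → k ≤ ∣ p ∣ → ∃[ q ] q ⊆ p × ∣ q ∣ ≡ k
⊆-ofSize {n} p {zero} _ = ⊥ , ⊆-min p , ∣⊥∣≡0 n
⊆-ofSize (inside ∷ p) {suc k} (s≤s k≤∣p∣) =
  let q , q⊆p , ∣q∣≡k = ⊆-ofSize p k≤∣p∣ in inside ∷ q , in⊆in q⊆p , cong suc ∣q∣≡k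
⊆-ofSize (outside ∷ p) {suc k} k<∣p∣ =
  let q , q⊆p , ∣q∣≡k = ⊆-ofSize p k<∣p∣ in outside ∷ q , out⊆ q⊆p , ∣q∣≡k

∣p∣≡1⇒∈-unique : ∀ {n} {p : Subset n} {x y} → ∣ p ∣ ≡ 1 → x ∈ p → y ∈ p → x ≡ y
∣p∣≡1⇒∈-unique {p = p} {x} {y} ∣p∣≡1 x∈p y∈p with x Fin.≟ y
... | yes x≡y = x≡y
... | no  x≢y = ⊥-elim (<-irrefl (trans (∣⁅x⁆∣≡1 x) (sym ∣p∣≡1)) (p⊂q⇒∣p∣<∣q∣ ⁅x⁆⊂p))
  where
  ⁅x⁆⊂p : ⁅ x ⁆ ⊂ p
  ⁅x⁆⊂p = (λ z∈⁅x⁆ → subst (_∈ p) (sym (x∈⁅y⁆⇒x≡y x z∈⁅x⁆)) x∈p)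
        , y , y∈p , x≢y ∘ sym ∘ x∈⁅y⁆⇒x≡y x

T-does⁻ : ∀ {p} {P : Set p} (P? : Dec P) → T (does P?) → P
T-does⁻ (yes p) _ = p

T-does⁺ : ∀ {p} {P : Set p} (P? : Dec P) → P → T (does P?)
T-does⁺ P? p = Equivalence.from T-≡ (dec-true P? p)

isKSubsetOf : ∀ {n} → ℕ → Subset n → Subset n → Bool
isKSubsetOf k Y S = (∣ S ∣ ≡ᵇ k) ∧ does (S ⊆? Y)

module _ {n k : ℕ} {Y S : Subset n} where

  isKSubsetOf⁺ : ∣ S ∣ ≡ k → S ⊆ Y → T (isKSubsetOf k Y S)
  isKSubsetOf⁺ ∣S∣≡k S⊆Y = Equivalence.from T-∧ (≡⇒≡ᵇ _ _ ∣S∣≡k , T-does⁺ (S ⊆? Y) S⊆Y)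

  isKSubsetOf⁻ : T (isKSubsetOf k Y S) → ∣ S ∣ ≡ k × S ⊆ Y
  isKSubsetOf⁻ h = let ∣S∣≡ᵇk , S⊆?Y = Equivalence.to T-∧ h in ≡ᵇ⇒≡ _ _ ∣S∣≡ᵇk , T-does⁻ (S ⊆? Y) S⊆?Y

𝟙-isKSubsetOf-∩ : ∀ {n} k (Y Z S : Subset n) →
  𝟙 (isKSubsetOf k (Y ∩ Z) S) ≤ 𝟙 (isKSubsetOf k Y S) * 𝟙 (does (S ⊆? Z))
𝟙-isKSubsetOf-∩ k Y Z S = ≤-trans (𝟙-mono split) (≤-reflexive (𝟙-∧ (isKSubsetOf k Y S) (does (S ⊆? Z))))
  where
  split : T (isKSubsetOf k (Y ∩ Z) S) → T (isKSubsetOf k Y S ∧ does (S ⊆? Z))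
  split h = let ∣S∣≡k , S⊆Y∩Z = isKSubsetOf⁻ h in
    Equivalence.from T-∧ (isKSubsetOf⁺ ∣S∣≡k (p∩q⊆p Y Z ∘ S⊆Y∩Z) , T-does⁺ (S ⊆? Z) (p∩q⊆q Y Z ∘ S⊆Y∩Z))

∑-allSubsets : ∀ {n} (f : Subset (suc n) → ℕ) →
  ∑ (allSubsets (suc n)) f ≡ ∑[ S ∈ allSubsets n ] f (inside ∷ S) + ∑[ S ∈ allSubsets n ] f (outside ∷ S)
∑-allSubsets {n} f =
  trans (∑-++ (map (inside ∷_) (allSubsets n)) _ f)
        (cong₂ _+_ (∑-map (inside ∷_) (allSubsets n) f) (∑-map (outside ∷_) (allSubsets n) f))

∑-isKSubsetOf≡C : ∀ {n} k (Y : Subset n) → ∑[ S ∈ allSubsets n ] 𝟙 (isKSubsetOf k Y S) ≡ ∣ Y ∣ C k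
∑-isKSubsetOf≡C {zero}  zero    [] = refl
∑-isKSubsetOf≡C {zero}  (suc k) [] = refl
∑-isKSubsetOf≡C {suc n} zero    (inside ∷ Y) =
  trans (∑-allSubsets (𝟙 ∘ isKSubsetOf zero (inside ∷ Y)))
        (cong₂ _+_ (∑-zero (allSubsets n)) (∑-isKSubsetOf≡C zero Y))
∑-isKSubsetOf≡C {suc n} (suc k) (inside ∷ Y) =
  trans (∑-allSubsets (𝟙 ∘ isKSubsetOf (suc k) (inside ∷ Y)))
    (trans (cong₂ _+_ (∑-isKSubsetOf≡C k Y) (∑-isKSubsetOf≡C (suc k) Y)) (nCk+nC[k+1]≡[n+1]C[k+1] ∣ Y ∣ k))
∑-isKSubsetOf≡C {suc n} k (outside ∷ Y) =
  trans (∑-allSubsets (𝟙 ∘ isKSubsetOf k (outside ∷ Y)))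
    (cong₂ _+_ (trans (∑-cong (allSubsets n) λ S → cong 𝟙 (∧-zeroʳ _)) (∑-zero (allSubsets n)))
               (∑-isKSubsetOf≡C k Y))

private
  pascal : ∀ n k → suc n C suc k ≡ n C k + n C suc k
  pascal n k = sym (nCk+nC[k+1]≡[n+1]C[k+1] n k)

C-monoˡ-≤ : ∀ {m n} k → m ≤ n → m C k ≤ n C k
C-monoˡ-≤           zero    _         = ≤-refl
C-monoˡ-≤ {zero}    (suc k) _         = z≤n
C-monoˡ-≤ {suc m} {suc n} (suc k) (s≤s m≤n) = begin
  suc m C suc k        ≡⟨ pascal m k ⟩
  m C k + m C suc k    ≤⟨ +-mono-≤ (C-monoˡ-≤ k m≤n) (C-monoˡ-≤ (suc k) m≤n) ⟩
  n C k + n C suc k    ≡⟨ pascal n k ⟨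
  suc n C suc k        ∎
  where open ≤-Reasoning

0<nCk : ∀ {n k} → k ≤ n → 0 < n C k
0<nCk {n}     {zero}  _         = s≤s z≤n
0<nCk {suc n} {suc k} (s≤s k≤n) = ≤-trans (0<nCk k≤n) (≤-trans (m≤m+n _ _) (≤-reflexive (sym (pascal n k))))

[1+k]*nC[1+k]≤n*nCk : ∀ n k → suc k * (n C suc k) ≤ n * (n C k)
[1+k]*nC[1+k]≤n*nCk zero    k    = ≤-reflexive (*-zeroʳ (suc k))
[1+k]*nC[1+k]≤n*nCk (suc n) zero = ≤-reflexive (trans (*-identityˡ _) (trans (nC1≡n (suc n)) (sym (*-identityʳ (suc n)))))
[1+k]*nC[1+k]≤n*nCk (suc n) (suc k) = begin
  suc (suc k) * (suc n C suc (suc k))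
    ≡⟨ cong (suc (suc k) *_) (pascal n (suc k)) ⟩
  suc (suc k) * (n C suc k + n C suc (suc k))
    ≡⟨ expand (n C suc k) (n C suc (suc k)) k ⟩
  n C suc k + (suc k * (n C suc k) + suc (suc k) * (n C suc (suc k)))
    ≤⟨ +-monoʳ-≤ (n C suc k) (+-mono-≤ ([1+k]*nC[1+k]≤n*nCk n k) ([1+k]*nC[1+k]≤n*nCk n (suc k))) ⟩
  n C suc k + (n * (n C k) + n * (n C suc k))
    ≤⟨ +-monoˡ-≤ _ (m≤n+m (n C suc k) (n C k)) ⟩
  n C k + n C suc k + (n * (n C k) + n * (n C suc k))
    ≡⟨ collect (n C k) (n C suc k) n ⟩
  suc n * (n C k + n C suc k)
    ≡⟨ cong (suc n *_) (pascal n k) ⟨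
  suc n * (suc n C suc k) ∎
  where
  open ≤-Reasoning
  expand : ∀ x y k → suc (suc k) * (x + y) ≡ x + (suc k * x + suc (suc k) * y)
  expand = solve-∀
  collect : ∀ x y n → x + y + (n * x + n * y) ≡ suc n * (x + y)
  collect = solve-∀

nC[1+k]≤n*nCk : ∀ n k → n C suc k ≤ n * (n C k)
nC[1+k]≤n*nCk n k = ≤-trans (m≤n*m (n C suc k) (suc k)) ([1+k]*nC[1+k]≤n*nCk n k)

nCk*k!≤n^k : ∀ n k → (n C k) * k ! ≤ n ^ k
nCk*k!≤n^k n zero    = ≤-refl
nCk*k!≤n^k n (suc k) = begin
  (n C suc k) * (suc k * k !)   ≡⟨ *-assoc (n C suc k) (suc k) (k !) ⟨
  (n C suc k) * suc k * k !     ≡⟨ cong (_* k !) (*-comm (n C suc k) (suc k)) ⟩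
  suc k * (n C suc k) * k !     ≤⟨ *-monoˡ-≤ (k !) ([1+k]*nC[1+k]≤n*nCk n k) ⟩
  n * (n C k) * k !             ≡⟨ *-assoc n (n C k) (k !) ⟩
  n * ((n C k) * k !)           ≤⟨ *-monoʳ-≤ n (nCk*k!≤n^k n k) ⟩
  n * n ^ k                     ∎
  where open ≤-Reasoning

nCk≤n^k : ∀ n k → n C k ≤ n ^ k
nCk≤n^k n k = ≤-trans (m≤m*n (n C k) (k !) {{k !≢0}}) (nCk*k!≤n^k n k)

nC[k+r]≤nCk*n^r : ∀ n k r → n C (k + r) ≤ (n C k) * n ^ r
nC[k+r]≤nCk*n^r n k zero    = ≤-reflexive (trans (cong (n C_) (+-identityʳ k)) (sym (*-identityʳ (n C k))))
nC[k+r]≤nCk*n^r n k (suc r) = begin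
  n C (k + suc r)         ≡⟨ cong (n C_) (+-suc k r) ⟩
  n C suc (k + r)         ≤⟨ nC[1+k]≤n*nCk n (k + r) ⟩
  n * (n C (k + r))       ≤⟨ *-monoʳ-≤ n (nC[k+r]≤nCk*n^r n k r) ⟩
  n * ((n C k) * n ^ r)   ≡⟨ *-CS.x∙yz≈y∙xz n (n C k) (n ^ r) ⟩
  (n C k) * (n * n ^ r)   ∎
  where open ≤-Reasoning

m≤r+mC[1+r] : ∀ m r → m ≤ r + m C suc r
m≤r+mC[1+r] zero    r = z≤n
m≤r+mC[1+r] (suc m) r with r ≤? m
... | no  r≰m = ≤-trans (≰⇒> r≰m) (m≤m+n r _)
... | yes r≤m = begin
  suc m                      ≤⟨ +-mono-≤ (0<nCk r≤m) (m≤r+mC[1+r] m r) ⟩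
  m C r + (r + m C suc r)    ≡⟨ +-CS.x∙yz≈y∙xz (m C r) r (m C suc r) ⟩
  r + (m C r + m C suc r)    ≡⟨ cong (r +_) (pascal m r) ⟨
  r + suc m C suc r          ∎
  where open ≤-Reasoning

2*s≤q! : ∀ {s q} → 2 ≤ s → s < q → 2 * s ≤ q !
2*s≤q! {s} {suc q} 2≤s (s≤s s≤q) = begin
  2 * s          ≡⟨ *-comm 2 s ⟩
  s * 2          ≤⟨ *-mono-≤ (m≤n⇒m≤1+n s≤q) (≤-trans (≤-trans 2≤s s≤q) (n≤n! q)) ⟩
  suc q * q !    ∎
  where
  open ≤-Reasoning
  n≤n! : ∀ n → n ≤ n !
  n≤n! zero    = z≤n
  n≤n! (suc n) = m≤m*n (suc n) (n !) {{n !≢0}}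

M*nC[1+s+k]≤m^[1+k]*nCs : ∀ {n m} M s k → n * M ≤ m → n ≤ m → M * (n C suc (s + k)) ≤ m ^ suc k * (n C s)
M*nC[1+s+k]≤m^[1+k]*nCs {n} {m} M s k nM≤m n≤m = begin
  M * (n C suc (s + k))           ≡⟨ cong (λ j → M * (n C j)) (+-suc s k) ⟨
  M * (n C (s + suc k))           ≤⟨ *-monoʳ-≤ M (nC[k+r]≤nCk*n^r n s (suc k)) ⟩
  M * ((n C s) * n ^ suc k)       ≡⟨ shuffle M (n C s) n (n ^ k) ⟩
  (n C s) * (n * M * n ^ k)       ≤⟨ *-monoʳ-≤ (n C s) (*-mono-≤ nM≤m (^-monoˡ-≤ k n≤m)) ⟩
  (n C s) * (m * m ^ k)           ≡⟨ *-comm (n C s) _ ⟩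
  m ^ suc k * (n C s)             ∎
  where
  open ≤-Reasoning
  shuffle : ∀ M c n y → M * (c * (n * y)) ≡ c * (n * M * y)
  shuffle = solve-∀

[2+k]!*b*nC[2+k]≤a*m^[1+k]*n : ∀ {n m} a b k → n * b ≤ a * m → n ≤ m →
  suc (suc k) ! * b * (n C suc (suc k)) ≤ a * m ^ suc k * n
[2+k]!*b*nC[2+k]≤a*m^[1+k]*n {n} {m} a b k nb≤am n≤m = begin
  q ! * b * (n C q)          ≡⟨ shuffle (q !) b (n C q) ⟩
  (n C q) * q ! * b          ≤⟨ *-monoˡ-≤ b (nCk*k!≤n^k n q) ⟩
  n * (n * n ^ k) * b        ≡⟨ shuffle′ n (n ^ k) b ⟩
  n * b * n ^ k * n          ≤⟨ *-monoˡ-≤ n (*-mono-≤ nb≤am (^-monoˡ-≤ k n≤m)) ⟩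
  a * m * m ^ k * n          ≡⟨ cong (_* n) (*-assoc a m (m ^ k)) ⟩
  a * m ^ suc k * n          ∎
  where
  open ≤-Reasoning
  q : ℕ
  q = suc (suc k)
  shuffle : ∀ f b c → f * b * c ≡ c * f * b
  shuffle = solve-∀
  shuffle′ : ∀ n y b → n * (n * y) * b ≡ n * b * y * n
  shuffle′ = solve-∀

module _ {a} {A : Set a} (xs : List A) (d : A → ℕ) {n} (d≤n : ∀ x → d x ≤ n) where

  smallDeg-∑C≤ : ∀ {s q t b} → s < q → 1 ≤ t → ∑[ x ∈ xs ] (d x C s) ≤ t * n ^ s →
    2 * b * ∑[ x ∈ xs ] (𝟙 (not (n ≤ᵇ d x * (2 * t * b))) * (d x C q)) ≤ n ^ q
  smallDeg-∑C≤ {s} {t = t} {b} s<q 1≤t ∑C≤ with m≤n⇒∃[o]m+o≡n s<q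
  ... | k , refl = *-cancelˡ-≤ t {{>-nonZero 1≤t}} (begin
    t * (2 * b * ∑[ x ∈ xs ] (𝟙 (small x) * Cq x))  ≡⟨ pull t b _ ⟩
    M * ∑[ x ∈ xs ] (𝟙 (small x) * Cq x)            ≡⟨ *-distribˡ-∑ M xs _ ⟩
    ∑[ x ∈ xs ] (M * (𝟙 (small x) * Cq x))          ≡⟨ ∑-cong xs (λ x → *-CS.x∙yz≈y∙xz M (𝟙 (small x)) (Cq x)) ⟩
    ∑[ x ∈ xs ] (𝟙 (small x) * (M * Cq x))          ≤⟨ ∑-mono-≤ xs (λ x → 𝟙*≤ (small x) (M*Cq≤ x)) ⟩
    ∑[ x ∈ xs ] (n ^ suc k * (d x C s))             ≡⟨ *-distribˡ-∑ (n ^ suc k) xs _ ⟨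
    n ^ suc k * ∑[ x ∈ xs ] (d x C s)               ≤⟨ *-monoʳ-≤ (n ^ suc k) ∑C≤ ⟩
    n * n ^ k * (t * n ^ s)                         ≡⟨ regroup n (n ^ k) t (n ^ s) ⟩
    t * (n * (n ^ s * n ^ k))                       ≡⟨ cong (λ m → t * (n * m)) (^-distribˡ-+-* n s k) ⟨
    t * n ^ (suc s + k)                             ∎)
    where
    open ≤-Reasoning
    M : ℕ
    M = 2 * t * b
    small : A → Bool
    small x = not (n ≤ᵇ d x * M)
    Cq : A → ℕ
    Cq x = d x C suc (s + k)
    pull : ∀ t b L → t * (2 * b * L) ≡ 2 * t * b * L
    pull = solve-∀
    regroup : ∀ n y t z → n * y * (t * z) ≡ t * (n * (z * y))
    regroup = solve-∀
    M*Cq≤ : ∀ x → T (small x) → M * Cq x ≤ n ^ suc k * (d x C s)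
    M*Cq≤ x is-small = M*nC[1+s+k]≤m^[1+k]*nCs M s k (<⇒≤ (≰⇒> (T-not⇒¬T is-small ∘ ≤⇒≤ᵇ))) (d≤n x)

  bigDeg-∑C≤ : ∀ {s q a b} (big : A → Bool) → 2 ≤ q → 2 * s ≤ q ! →
    ∑[ x ∈ xs ] (𝟙 (big x) * d x) ≤ n * s →
    2 * b * ∑[ x ∈ xs ] (𝟙 (big x) * (𝟙 (d x * b ≤ᵇ a * n) * (d x C q))) ≤ a * n ^ q
  bigDeg-∑C≤ {s} {q@(suc (suc k))} {a} {b} big (s≤s (s≤s z≤n)) 2s≤q! ∑≤ =
    *-cancelˡ-≤ (q !) {{q !≢0}} (begin
      q ! * (2 * b * ∑ xs f)        ≡⟨ pull (q !) b (∑ xs f) ⟩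
      2 * (q ! * b * ∑ xs f)        ≤⟨ *-monoʳ-≤ 2 q!*b*∑f≤ ⟩
      2 * (a * n ^ suc k * (n * s)) ≡⟨ regroup a (n ^ suc k) n s ⟩
      a * n ^ q * (2 * s)           ≤⟨ *-monoʳ-≤ (a * n ^ q) 2s≤q! ⟩
      a * n ^ q * q !               ≡⟨ *-comm (a * n ^ q) (q !) ⟩
      q ! * (a * n ^ q)             ∎)
    where
    open ≤-Reasoning
    low : A → Bool
    low x = d x * b ≤ᵇ a * n
    pull : ∀ f b L → f * (2 * b * L) ≡ 2 * (f * b * L)
    pull = solve-∀
    regroup : ∀ a y n s → 2 * (a * y * (n * s)) ≡ a * (n * y) * (2 * s)
    regroup = solve-∀
    f : A → ℕ
    f x = 𝟙 (big x) * (𝟙 (low x) * (d x C q))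
    term≤ : ∀ x → q ! * b * f x ≤ a * n ^ suc k * (𝟙 (big x) * d x)
    term≤ x = begin
      q ! * b * (𝟙 (big x) * (𝟙 (low x) * (d x C q)))
        ≡⟨ *-CS.x∙yz≈y∙xz (q ! * b) (𝟙 (big x)) _ ⟩
      𝟙 (big x) * (q ! * b * (𝟙 (low x) * (d x C q)))
        ≡⟨ cong (𝟙 (big x) *_) (*-CS.x∙yz≈y∙xz (q ! * b) (𝟙 (low x)) (d x C q)) ⟩
      𝟙 (big x) * (𝟙 (low x) * (q ! * b * (d x C q)))
        ≤⟨ 𝟙*-mono (big x) (λ _ → 𝟙*≤ (low x) λ is-low →
             [2+k]!*b*nC[2+k]≤a*m^[1+k]*n a b k (≤ᵇ⇒≤ _ _ is-low) (d≤n x)) ⟩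
      𝟙 (big x) * (a * n ^ suc k * d x)
        ≡⟨ *-CS.x∙yz≈y∙xz (𝟙 (big x)) (a * n ^ suc k) (d x) ⟩
      a * n ^ suc k * (𝟙 (big x) * d x) ∎
    q!*b*∑f≤ : q ! * b * ∑ xs f ≤ a * n ^ suc k * (n * s)
    q!*b*∑f≤ = begin
      q ! * b * ∑ xs f                                 ≡⟨ *-distribˡ-∑ (q ! * b) xs f ⟩
      ∑[ x ∈ xs ] (q ! * b * f x)                      ≤⟨ ∑-mono-≤ xs term≤ ⟩
      ∑[ x ∈ xs ] (a * n ^ suc k * (𝟙 (big x) * d x))  ≡⟨ *-distribˡ-∑ (a * n ^ suc k) xs _ ⟨
      a * n ^ suc k * ∑[ x ∈ xs ] (𝟙 (big x) * d x)    ≤⟨ *-monoʳ-≤ (a * n ^ suc k) ∑≤ ⟩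
      a * n ^ suc k * (n * s)                          ∎

  lowDeg-∑C≤ : ∀ {s q t a b} → 2 ≤ s → s < q → 1 ≤ t → 1 ≤ a →
    ∑[ x ∈ xs ] (d x C s) ≤ t * n ^ s →
    ∑[ x ∈ xs ] (𝟙 (n ≤ᵇ d x * (2 * t * b)) * d x) ≤ n * s →
    b * ∑[ x ∈ xs ] (𝟙 (d x * b ≤ᵇ a * n) * (d x C q)) ≤ a * n ^ q
  lowDeg-∑C≤ {s} {q} {t} {a} {b} 2≤s s<q 1≤t 1≤a ∑C≤ ∑big≤ = *-cancelˡ-≤ 2 (begin
    2 * (b * ∑[ x ∈ xs ] (𝟙 (low x) * Cq x))
      ≤⟨ *-monoʳ-≤ 2 (*-monoʳ-≤ b (≤-trans (∑-mono-≤ xs split) (≤-reflexive (∑-distrib-+ xs _ _)))) ⟩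
    2 * (b * (∑[ x ∈ xs ] (𝟙 (not (big x)) * Cq x) + ∑[ x ∈ xs ] (𝟙 (big x) * (𝟙 (low x) * Cq x))))
      ≡⟨ distrib b _ _ ⟩
    2 * b * ∑[ x ∈ xs ] (𝟙 (not (big x)) * Cq x) + 2 * b * ∑[ x ∈ xs ] (𝟙 (big x) * (𝟙 (low x) * Cq x))
      ≤⟨ +-mono-≤ (smallDeg-∑C≤ {b = b} s<q 1≤t ∑C≤)
                  (bigDeg-∑C≤ {a = a} {b} big (≤-trans 2≤s (<⇒≤ s<q)) (2*s≤q! 2≤s s<q) ∑big≤) ⟩
    n ^ q + a * n ^ q
      ≤⟨ +-monoˡ-≤ (a * n ^ q) (m≤n*m (n ^ q) a {{>-nonZero 1≤a}}) ⟩
    a * n ^ q + a * n ^ q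
      ≡⟨ cong (a * n ^ q +_) (+-identityʳ (a * n ^ q)) ⟨
    2 * (a * n ^ q) ∎)
    where
    open ≤-Reasoning
    big low : A → Bool
    big x = n ≤ᵇ d x * (2 * t * b)
    low x = d x * b ≤ᵇ a * n
    Cq : A → ℕ
    Cq x = d x C q
    split : ∀ x → 𝟙 (low x) * Cq x ≤ 𝟙 (not (big x)) * Cq x + 𝟙 (big x) * (𝟙 (low x) * Cq x)
    split x with big x
    ... | true  = ≤-reflexive (sym (+-identityʳ _))
    ... | false = ≤-trans (𝟙*≤ (low x) (λ _ → ≤-refl)) (≤-trans (m≤m+n _ 0) (m≤m+n _ _))
    distrib : ∀ b x y → 2 * (b * (x + y)) ≡ 2 * b * x + 2 * b * y
    distrib = solve-∀

module _ {n} (f : Fin n → Bool) where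

  all-allFin⁻ : T (all f (allFin n)) → ∀ i → T (f i)
  all-allFin⁻ h i = All.lookup (all⁺ f (allFin n) h) (∈-allFin i)

  all-allFin⁺ : (∀ i → T (f i)) → T (all f (allFin n))
  all-allFin⁺ h = all⁻ f {allFin n} (All.tabulate λ {i} _ → h i)

module _ {n} (G : Graph n) where

  nbhd : Fin n → Subset n
  nbhd u = tabulate (adj G u)

  commonNbhd : Subset n → Subset n
  commonNbhd S = tabulate (λ w → does (S ⊆? nbhd w))

  ∈-commonNbhd⁺ : ∀ {S w} → S ⊆ nbhd w → w ∈ commonNbhd S
  ∈-commonNbhd⁺ {S} {w} = ∈-tabulate⁺ ∘ T-does⁺ (S ⊆? nbhd w)

  ∈-commonNbhd⁻ : ∀ {S w} → w ∈ commonNbhd S → S ⊆ nbhd w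
  ∈-commonNbhd⁻ {S} {w} = T-does⁻ (S ⊆? nbhd w) ∘ ∈-tabulate⁻

  commonNbhd-anti : ∀ {S S′} → S ⊆ S′ → commonNbhd S′ ⊆ commonNbhd S
  commonNbhd-anti S⊆S′ w∈ = ∈-commonNbhd⁺ (∈-commonNbhd⁻ w∈ ∘ S⊆S′)

  isKpq⁻ : ∀ {p q A B} → T (isKpq G p q A B) → ∣ A ∣ ≡ p × ∣ B ∣ ≡ q × A ⊆ commonNbhd B
  isKpq⁻ {p} {q} {A} {B} h =
    let ∣A∣≡ᵇp , h₁ = Equivalence.to (T-∧ {∣ A ∣ ≡ᵇ p}) h
        ∣B∣≡ᵇq , h₂ = Equivalence.to (T-∧ {∣ B ∣ ≡ᵇ q}) h₁
        _ , complete = Equivalence.to (T-∧ {all (λ i → not (lookup A i ∧ lookup B i)) (allFin n)}) h₂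
        edge : ∀ {i j} → i ∈ A → j ∈ B → T (adj G i j)
        edge = λ {i} {j} i∈A j∈B →
          subst (λ x → T (not x ∨ adj G i j)) (cong₂ _∧_ ([]=⇒lookup i∈A) ([]=⇒lookup j∈B))
            (all-allFin⁻ _ (all-allFin⁻ _ complete i) j)
    in ≡ᵇ⇒≡ _ _ ∣A∣≡ᵇp , ≡ᵇ⇒≡ _ _ ∣B∣≡ᵇq , λ i∈A → ∈-commonNbhd⁺ (λ j∈B → ∈-tabulate⁺ (edge i∈A j∈B))

  isKpq⁺ : ∀ {p q A B} → ∣ A ∣ ≡ p → ∣ B ∣ ≡ q → B ⊆ commonNbhd A → T (isKpq G p q A B)
  isKpq⁺ {p} {q} {A} {B} ∣A∣≡p ∣B∣≡q B⊆ =
    Equivalence.from T-∧ (≡⇒≡ᵇ _ _ ∣A∣≡p , Equivalence.from T-∧ (≡⇒≡ᵇ _ _ ∣B∣≡q ,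
      Equivalence.from T-∧ (all-allFin⁺ _ disjoint , all-allFin⁺ _ λ i → all-allFin⁺ _ (complete i))))
    where
    edge : ∀ {i j} → lookup A i ≡ true → lookup B j ≡ true → T (adj G i j)
    edge {i} {j} Aᵢ Bⱼ = subst T (Graph.sym G j i)
      (∈-tabulate⁻ (∈-commonNbhd⁻ (B⊆ (lookup⇒[]= j B Bⱼ)) (lookup⇒[]= i A Aᵢ)))
    disjoint : ∀ i → T (not (lookup A i ∧ lookup B i))
    disjoint i with lookup A i in Aᵢ | lookup B i in Bᵢ
    ... | true  | true  = subst T (Graph.irrefl G i) (edge Aᵢ Bᵢ)
    ... | true  | false = _
    ... | false | _     = _
    complete : ∀ i j → T (not (lookup A i ∧ lookup B j) ∨ adj G i j)
    complete i j with lookup A i in Aᵢ | lookup B j in Bⱼ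
    ... | true  | true  = edge Aᵢ Bⱼ
    ... | true  | false = _
    ... | false | _     = _

  countLowCopies≡∑∑ : ∀ p q a b → countLowCopies G p q a b ≡
    ∑[ B ∈ allSubsets n ] ∑[ A ∈ allSubsets n ] 𝟙 (isKpq G p q A B ∧ meetsLowDeg G a b A)
  countLowCopies≡∑∑ p q a b =
    trans (length-filter≡∑𝟙 (λ AB → isKpq G p q (proj₁ AB) (proj₂ AB) ∧ meetsLowDeg G a b (proj₁ AB)) pairs)
      (trans (∑-cartesianProduct (allSubsets n) (allSubsets n) _) (∑-comm (allSubsets n) (allSubsets n) _))
    where
    pairs : List (Subset n × Subset n)
    pairs = cartesianProduct (allSubsets n) (allSubsets n)

  ∑-𝟙∈*deg≡∑∣∩nbhd∣ : ∀ U → ∑[ u ∈ allFin n ] (𝟙 (lookup U u) * deg G u) ≡ ∑[ w ∈ allFin n ] ∣ U ∩ nbhd w ∣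
  ∑-𝟙∈*deg≡∑∣∩nbhd∣ U = begin
    ∑[ u ∈ allFin n ] (𝟙 (lookup U u) * deg G u)
      ≡⟨ ∑-cong (allFin n) (λ u → trans (cong (𝟙 (lookup U u) *_) (∣tabulate∣≡∑𝟙 (adj G u)))
                                         (*-distribˡ-∑ (𝟙 (lookup U u)) (allFin n) _)) ⟩
    ∑[ u ∈ allFin n ] ∑[ w ∈ allFin n ] (𝟙 (lookup U u) * 𝟙 (adj G u w))
      ≡⟨ ∑-comm (allFin n) (allFin n) _ ⟩
    ∑[ w ∈ allFin n ] ∑[ u ∈ allFin n ] (𝟙 (lookup U u) * 𝟙 (adj G u w))
      ≡⟨ ∑-cong (allFin n) (λ w → trans (∑-cong (allFin n) (edge w)) (sym (∣p∣≡∑𝟙 (U ∩ nbhd w)))) ⟩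
    ∑[ w ∈ allFin n ] ∣ U ∩ nbhd w ∣ ∎
    where
    open ≡-Reasoning
    edge : ∀ w u → 𝟙 (lookup U u) * 𝟙 (adj G u w) ≡ 𝟙 (lookup (U ∩ nbhd w) u)
    edge w u = begin
      𝟙 (lookup U u) * 𝟙 (adj G u w)       ≡⟨ 𝟙-∧ (lookup U u) (adj G u w) ⟨
      𝟙 (lookup U u ∧ adj G u w)           ≡⟨ cong (λ e → 𝟙 (lookup U u ∧ e)) (Graph.sym G u w) ⟩
      𝟙 (lookup U u ∧ adj G w u)           ≡⟨ cong (λ e → 𝟙 (lookup U u ∧ e)) (lookup∘tabulate (adj G w) u) ⟨
      𝟙 (lookup U u ∧ lookup (nbhd w) u)   ≡⟨ cong 𝟙 (lookup-zipWith _∧_ u U (nbhd w)) ⟨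
      𝟙 (lookup (U ∩ nbhd w) u)            ∎

  highDeg : ℕ → Subset n
  highDeg M = tabulate (λ u → n ≤ᵇ deg G u * M)

  ∣U∣*n≤M*∑deg : ∀ {M U} → U ⊆ highDeg M → ∣ U ∣ * n ≤ M * ∑[ u ∈ allFin n ] (𝟙 (lookup U u) * deg G u)
  ∣U∣*n≤M*∑deg {M} {U} U⊆H = begin
    ∣ U ∣ * n                                          ≡⟨ cong (_* n) (∣p∣≡∑𝟙 U) ⟩
    ∑[ u ∈ allFin n ] 𝟙 (lookup U u) * n               ≡⟨ *-comm _ n ⟩
    n * ∑[ u ∈ allFin n ] 𝟙 (lookup U u)               ≡⟨ *-distribˡ-∑ n (allFin n) _ ⟩
    ∑[ u ∈ allFin n ] (n * 𝟙 (lookup U u))             ≤⟨ ∑-mono-≤ (allFin n) term≤ ⟩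
    ∑[ u ∈ allFin n ] (M * (𝟙 (lookup U u) * deg G u)) ≡⟨ *-distribˡ-∑ M (allFin n) _ ⟨
    M * ∑[ u ∈ allFin n ] (𝟙 (lookup U u) * deg G u)   ∎
    where
    open ≤-Reasoning
    high : ∀ {u} → u ∈ highDeg M → n ≤ deg G u * M
    high {u} = ≤ᵇ⇒≤ n (deg G u * M) ∘ ∈-tabulate⁻
    term≤ : ∀ u → n * 𝟙 (lookup U u) ≤ M * (𝟙 (lookup U u) * deg G u)
    term≤ u = begin
      n * 𝟙 (lookup U u)                ≡⟨ *-comm n _ ⟩
      𝟙 (lookup U u) * n                ≤⟨ 𝟙*-mono (lookup U u) (high ∘ U⊆H ∘ T-lookup⇒∈) ⟩
      𝟙 (lookup U u) * (deg G u * M)    ≡⟨ *-CS.x∙yz≈z∙xy (𝟙 (lookup U u)) (deg G u) M ⟩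
      M * (𝟙 (lookup U u) * deg G u)    ∎

  lowDegᵇ : ℕ → ℕ → Fin n → Bool
  lowDegᵇ a b u = deg G u * b ≤ᵇ a * n

  countLowStars≤ : ∀ {q a b} → countLowCopies G 1 q a b ≤ ∑[ u ∈ allFin n ] (𝟙 (lowDegᵇ a b u) * (deg G u C q))
  countLowStars≤ {q} {a} {b} = begin
    countLowCopies G 1 q a b
      ≡⟨ countLowCopies≡∑∑ 1 q a b ⟩
    ∑[ B ∈ allSubsets n ] ∑[ A ∈ allSubsets n ] 𝟙 (isKpq G 1 q A B ∧ meetsLowDeg G a b A)
      ≤⟨ ∑-mono-≤ (allSubsets n) (λ B → ∑-mono-≤ (allSubsets n) (λ A → 𝟙-mono (star⇒ A B))) ⟩
    ∑[ B ∈ allSubsets n ] ∑[ A ∈ allSubsets n ] 𝟙 (isKSubsetOf 1 (centres B) A)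
      ≡⟨ ∑-cong (allSubsets n) (λ B → trans (∑-isKSubsetOf≡C 1 (centres B))
                                      (trans (nC1≡n ∣ centres B ∣) (∣tabulate∣≡∑𝟙 (centreᵇ B)))) ⟩
    ∑[ B ∈ allSubsets n ] ∑[ u ∈ allFin n ] 𝟙 (lowDegᵇ a b u ∧ isKSubsetOf q (nbhd u) B)
      ≡⟨ ∑-cong (allSubsets n) (λ B → ∑-cong (allFin n) (λ u → 𝟙-∧ (lowDegᵇ a b u) _)) ⟩
    ∑[ B ∈ allSubsets n ] ∑[ u ∈ allFin n ] (𝟙 (lowDegᵇ a b u) * 𝟙 (isKSubsetOf q (nbhd u) B))
      ≡⟨ ∑-comm (allSubsets n) (allFin n) _ ⟩
    ∑[ u ∈ allFin n ] ∑[ B ∈ allSubsets n ] (𝟙 (lowDegᵇ a b u) * 𝟙 (isKSubsetOf q (nbhd u) B))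
      ≡⟨ ∑-cong (allFin n) (λ u → trans (sym (*-distribˡ-∑ (𝟙 (lowDegᵇ a b u)) (allSubsets n) _))
                                  (cong (𝟙 (lowDegᵇ a b u) *_) (∑-isKSubsetOf≡C q (nbhd u)))) ⟩
    ∑[ u ∈ allFin n ] (𝟙 (lowDegᵇ a b u) * (deg G u C q)) ∎
    where
    open ≤-Reasoning
    centreᵇ : Subset n → Fin n → Bool
    centreᵇ B u = lowDegᵇ a b u ∧ isKSubsetOf q (nbhd u) B
    centres : Subset n → Subset n
    centres B = tabulate (centreᵇ B)
    star⇒ : ∀ A B → T (isKpq G 1 q A B ∧ meetsLowDeg G a b A) → T (isKSubsetOf 1 (centres B) A)
    star⇒ A B h =
      let isStar , meetsLow = Equivalence.to (T-∧ {isKpq G 1 q A B}) h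
          ∣A∣≡1 , ∣B∣≡q , A⊆ = isKpq⁻ {1} {q} {A} {B} isStar
          i , Aᵢ∧lowᵢ = Any.satisfied (any⁻ _ (allFin n) meetsLow)
          Aᵢ , lowᵢ = Equivalence.to (T-∧ {lookup A i}) Aᵢ∧lowᵢ
          centre : ∀ {x} → x ∈ A → T (lowDegᵇ a b x ∧ isKSubsetOf q (nbhd x) B)
          centre = λ x∈A → Equivalence.from T-∧
            ( subst (T ∘ lowDegᵇ a b) (∣p∣≡1⇒∈-unique ∣A∣≡1 (T-lookup⇒∈ Aᵢ) x∈A) lowᵢ
            , isKSubsetOf⁺ {S = B} ∣B∣≡q (∈-commonNbhd⁻ (A⊆ x∈A)))
      in isKSubsetOf⁺ {S = A} ∣A∣≡1 (∈-tabulate⁺ ∘ centre)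

  module _ {s t} (free : KstFree G s t) where

    ∣commonNbhd∣<t : ∀ {S} → s ≤ ∣ S ∣ → ∣ commonNbhd S ∣ < t
    ∣commonNbhd∣<t {S} s≤∣S∣ =
      let S′ , S′⊆S , ∣S′∣≡s = ⊆-ofSize S s≤∣S∣
      in ≤-<-trans (p⊆q⇒∣p∣≤∣q∣ (commonNbhd-anti S′⊆S)) (≰⇒> (no-Kst S′ ∣S′∣≡s))
      where
      no-Kst : ∀ S′ → ∣ S′ ∣ ≡ s → ¬ t ≤ ∣ commonNbhd S′ ∣
      no-Kst S′ ∣S′∣≡s t≤∣N∣ =
        let B , B⊆N , ∣B∣≡t = ⊆-ofSize (commonNbhd S′) t≤∣N∣
        in subst T (free S′ B) (isKpq⁺ {s} {t} {S′} {B} ∣S′∣≡s ∣B∣≡t B⊆N)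

    ∑-C-∣∩nbhd∣≤ : ∀ U → ∑[ w ∈ allFin n ] (∣ U ∩ nbhd w ∣ C s) ≤ t * (∣ U ∣ C s)
    ∑-C-∣∩nbhd∣≤ U = begin
      ∑[ w ∈ allFin n ] (∣ U ∩ nbhd w ∣ C s)
        ≡⟨ ∑-cong (allFin n) (λ w → ∑-isKSubsetOf≡C s (U ∩ nbhd w)) ⟨
      ∑[ w ∈ allFin n ] ∑[ S ∈ allSubsets n ] 𝟙 (isKSubsetOf s (U ∩ nbhd w) S)
        ≡⟨ ∑-comm (allFin n) (allSubsets n) _ ⟩
      ∑[ S ∈ allSubsets n ] ∑[ w ∈ allFin n ] 𝟙 (isKSubsetOf s (U ∩ nbhd w) S)
        ≤⟨ ∑-mono-≤ (allSubsets n) (λ S → ∑-mono-≤ (allFin n) (λ w → 𝟙-isKSubsetOf-∩ s U (nbhd w) S)) ⟩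
      ∑[ S ∈ allSubsets n ] ∑[ w ∈ allFin n ] (𝟙 (isKSubsetOf s U S) * 𝟙 (does (S ⊆? nbhd w)))
        ≡⟨ ∑-cong (allSubsets n) (λ S → trans (sym (*-distribˡ-∑ (𝟙 (isKSubsetOf s U S)) (allFin n) _))
             (cong (𝟙 (isKSubsetOf s U S) *_) (sym (∣tabulate∣≡∑𝟙 (λ w → does (S ⊆? nbhd w)))))) ⟩
      ∑[ S ∈ allSubsets n ] (𝟙 (isKSubsetOf s U S) * ∣ commonNbhd S ∣)
        ≤⟨ ∑-mono-≤ (allSubsets n) (λ S → 𝟙*-mono (isKSubsetOf s U S) (few-common S)) ⟩
      ∑[ S ∈ allSubsets n ] (𝟙 (isKSubsetOf s U S) * t)
        ≡⟨ ∑-cong (allSubsets n) (λ S → *-comm _ t) ⟩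
      ∑[ S ∈ allSubsets n ] (t * 𝟙 (isKSubsetOf s U S))
        ≡⟨ *-distribˡ-∑ t (allSubsets n) _ ⟨
      t * ∑[ S ∈ allSubsets n ] 𝟙 (isKSubsetOf s U S)
        ≡⟨ cong (t *_) (∑-isKSubsetOf≡C s U) ⟩
      t * (∣ U ∣ C s) ∎
      where
      open ≤-Reasoning
      few-common : ∀ S → T (isKSubsetOf s U S) → ∣ commonNbhd S ∣ ≤ t
      few-common S h = <⇒≤ (∣commonNbhd∣<t {S} (≤-reflexive (sym (proj₁ (isKSubsetOf⁻ {Y = U} {S} h)))))

    ∑-degCs≤ : ∑[ u ∈ allFin n ] (deg G u C s) ≤ t * n ^ s
    ∑-degCs≤ = begin
      ∑[ u ∈ allFin n ] (deg G u C s)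
        ≡⟨ ∑-cong (allFin n) (λ u → cong (λ X → ∣ X ∣ C s) (∩-identityˡ (nbhd u))) ⟨
      ∑[ u ∈ allFin n ] (∣ ⊤ ∩ nbhd u ∣ C s) ≤⟨ ∑-C-∣∩nbhd∣≤ ⊤ ⟩
      t * (∣ ⊤ {n} ∣ C s)                 ≡⟨ cong (λ m → t * (m C s)) (∣⊤∣≡n n) ⟩
      t * (n C s)                          ≤⟨ *-monoʳ-≤ t (nCk≤n^k n s) ⟩
      t * n ^ s                            ∎
      where open ≤-Reasoning

    countLowCopies≤ : ∀ {p q a b} → s ≤ q → countLowCopies G p q a b ≤ (t C p) * n ^ q
    countLowCopies≤ {p} {q} {a} {b} s≤q = begin
      countLowCopies G p q a b
        ≡⟨ countLowCopies≡∑∑ p q a b ⟩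
      ∑[ B ∈ allSubsets n ] ∑[ A ∈ allSubsets n ] 𝟙 (isKpq G p q A B ∧ meetsLowDeg G a b A)
        ≤⟨ ∑-mono-≤ (allSubsets n) (λ B → ∑-mono-≤ (allSubsets n) (λ A → copy≤ A B)) ⟩
      ∑[ B ∈ allSubsets n ] ∑[ A ∈ allSubsets n ] (𝟙 (isKSubsetOf q ⊤ B) * 𝟙 (isKSubsetOf p (commonNbhd B) A))
        ≡⟨ ∑-cong (allSubsets n) (λ B → trans (sym (*-distribˡ-∑ (𝟙 (isKSubsetOf q ⊤ B)) (allSubsets n) _))
                                              (cong (𝟙 (isKSubsetOf q ⊤ B) *_) (∑-isKSubsetOf≡C p (commonNbhd B)))) ⟩
      ∑[ B ∈ allSubsets n ] (𝟙 (isKSubsetOf q ⊤ B) * (∣ commonNbhd B ∣ C p))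
        ≤⟨ ∑-mono-≤ (allSubsets n) (λ B → 𝟙*-mono (isKSubsetOf q ⊤ B) (C-monoˡ-≤ p ∘ few-common B)) ⟩
      ∑[ B ∈ allSubsets n ] (𝟙 (isKSubsetOf q ⊤ B) * (t C p))
        ≡⟨ ∑-cong (allSubsets n) (λ B → *-comm _ (t C p)) ⟩
      ∑[ B ∈ allSubsets n ] ((t C p) * 𝟙 (isKSubsetOf q ⊤ B))
        ≡⟨ *-distribˡ-∑ (t C p) (allSubsets n) _ ⟨
      (t C p) * ∑[ B ∈ allSubsets n ] 𝟙 (isKSubsetOf q ⊤ B)
        ≡⟨ cong ((t C p) *_) (trans (∑-isKSubsetOf≡C q (⊤ {n})) (cong (_C q) (∣⊤∣≡n n))) ⟩
      (t C p) * (n C q)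
        ≤⟨ *-monoʳ-≤ (t C p) (nCk≤n^k n q) ⟩
      (t C p) * n ^ q ∎
      where
      open ≤-Reasoning
      copy≤ : ∀ A B → 𝟙 (isKpq G p q A B ∧ meetsLowDeg G a b A)
                    ≤ 𝟙 (isKSubsetOf q ⊤ B) * 𝟙 (isKSubsetOf p (commonNbhd B) A)
      copy≤ A B = ≤-trans (𝟙-mono copy⇒) (≤-reflexive (𝟙-∧ (isKSubsetOf q ⊤ B) _))
        where
        copy⇒ : T (isKpq G p q A B ∧ meetsLowDeg G a b A) → T (isKSubsetOf q ⊤ B ∧ isKSubsetOf p (commonNbhd B) A)
        copy⇒ h =
          let ∣A∣≡p , ∣B∣≡q , A⊆N = isKpq⁻ {p} {q} {A} {B} (proj₁ (Equivalence.to (T-∧ {isKpq G p q A B}) h))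
          in Equivalence.from T-∧ (isKSubsetOf⁺ {S = B} ∣B∣≡q ⊆⊤ , isKSubsetOf⁺ {S = A} ∣A∣≡p A⊆N)
      few-common : ∀ B → T (isKSubsetOf q ⊤ B) → ∣ commonNbhd B ∣ ≤ t
      few-common B h =
        <⇒≤ (∣commonNbhd∣<t {B} (≤-trans s≤q (≤-reflexive (sym (proj₁ (isKSubsetOf⁻ {Y = ⊤} {B} h))))))

    countLowCopies-manyCentres : ∀ {p q a b} → s ≤ q → 1 ≤ a → t ^ suc (suc p) * b < n →
      countLowCopies G (suc (suc p)) q a b * b ≤ a * n ^ (suc p + q)
    countLowCopies-manyCentres {p} {q} {a} {b} s≤q 1≤a tᵖb<n = begin
      countLowCopies G P q a b * b ≤⟨ *-monoˡ-≤ b (countLowCopies≤ {P} {q} {a} {b} s≤q) ⟩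
      (t C P) * n ^ q * b          ≤⟨ *-monoˡ-≤ b (*-monoˡ-≤ (n ^ q) (nCk≤n^k t P)) ⟩
      t ^ P * n ^ q * b            ≡⟨ *-CS.xy∙z≈y∙xz (t ^ P) (n ^ q) b ⟩
      n ^ q * (t ^ P * b)          ≤⟨ *-monoʳ-≤ (n ^ q) (<⇒≤ tᵖb<n) ⟩
      n ^ q * n                    ≡⟨ *-comm (n ^ q) n ⟩
      n ^ suc q                    ≤⟨ ^-monoʳ-≤ n {{>-nonZero (≤-<-trans z≤n tᵖb<n)}} (s≤s (m≤n+m q p)) ⟩
      n ^ (suc p + q)              ≤⟨ m≤n*m (n ^ (suc p + q)) a {{>-nonZero 1≤a}} ⟩
      a * n ^ (suc p + q)          ∎
      where
      open ≤-Reasoning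
      P : ℕ
      P = suc (suc p)

  module _ {r t} (free : KstFree G (suc r) t) where

    ∑-𝟙∈*deg≤ : ∀ U → ∑[ u ∈ allFin n ] (𝟙 (lookup U u) * deg G u) ≤ n * r + t * (∣ U ∣ C suc r)
    ∑-𝟙∈*deg≤ U = begin
      ∑[ u ∈ allFin n ] (𝟙 (lookup U u) * deg G u)          ≡⟨ ∑-𝟙∈*deg≡∑∣∩nbhd∣ U ⟩
      ∑[ w ∈ allFin n ] ∣ U ∩ nbhd w ∣                      ≤⟨ ∑-mono-≤ (allFin n) (λ w → m≤r+mC[1+r] _ r) ⟩
      ∑[ w ∈ allFin n ] (r + ∣ U ∩ nbhd w ∣ C suc r)        ≡⟨ ∑-distrib-+ (allFin n) (λ _ → r) _ ⟩
      ∑[ w ∈ allFin n ] r + ∑[ w ∈ allFin n ] (∣ U ∩ nbhd w ∣ C suc r)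
        ≤⟨ +-mono-≤ (≤-reflexive (trans (∑-const (allFin n) r) (cong (_* r) (length-tabulate {n = n} id))))
                    (∑-C-∣∩nbhd∣≤ free U) ⟩
      n * r + t * (∣ U ∣ C suc r)                            ∎
      where open ≤-Reasoning

    ∣highDeg∣< : ∀ {M} → 1 ≤ M → t * ((suc r * M) C suc r) < n → ∣ highDeg M ∣ < suc r * M
    ∣highDeg∣< {M} 1≤M R<n = ≰⇒> λ K≤∣H∣ →
      let U , U⊆H , ∣U∣≡K = ⊆-ofSize (highDeg M) K≤∣H∣ in <-irrefl refl (begin-strict
        suc r * M * n                             ≡⟨ cong (_* n) ∣U∣≡K ⟨
        ∣ U ∣ * n                                 ≤⟨ ∣U∣*n≤M*∑deg U⊆H ⟩
        M * ∑[ u ∈ allFin n ] (𝟙 (lookup U u) * deg G u)  ≤⟨ *-monoʳ-≤ M (∑-𝟙∈*deg≤ U) ⟩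
        M * (n * r + t * (∣ U ∣ C suc r))          ≡⟨ cong (λ k → M * (n * r + t * (k C suc r))) ∣U∣≡K ⟩
        M * (n * r + t * ((suc r * M) C suc r))    <⟨ *-monoʳ-< M {{>-nonZero 1≤M}} (+-monoʳ-< (n * r) R<n) ⟩
        M * (n * r + n)                            ≡⟨ regroup M n r ⟩
        suc r * M * n                              ∎)
      where
      open ≤-Reasoning
      regroup : ∀ M n r → M * (n * r + n) ≡ suc r * M * n
      regroup = solve-∀

    ∑-deg-highDeg≤ : ∀ {M} → 1 ≤ M → t * ((suc r * M) C suc r) < n →
      ∑[ u ∈ allFin n ] (𝟙 (n ≤ᵇ deg G u * M) * deg G u) ≤ n * suc r
    ∑-deg-highDeg≤ {M} 1≤M R<n = begin
      ∑[ u ∈ allFin n ] (𝟙 (n ≤ᵇ deg G u * M) * deg G u)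
        ≡⟨ ∑-cong (allFin n) (λ u → cong (λ x → 𝟙 x * deg G u) (lookup∘tabulate _ u)) ⟨
      ∑[ u ∈ allFin n ] (𝟙 (lookup (highDeg M) u) * deg G u)
        ≤⟨ ∑-𝟙∈*deg≤ (highDeg M) ⟩
      n * r + t * (∣ highDeg M ∣ C suc r)
        ≤⟨ +-monoʳ-≤ (n * r) (*-monoʳ-≤ t (C-monoˡ-≤ (suc r) (<⇒≤ (∣highDeg∣< 1≤M R<n)))) ⟩
      n * r + t * ((suc r * M) C suc r)
        ≤⟨ +-monoʳ-≤ (n * r) (<⇒≤ R<n) ⟩
      n * r + n
        ≡⟨ trans (+-comm (n * r) n) (sym (*-suc n r)) ⟩
      n * suc r ∎
      where open ≤-Reasoning

    countLowCopies-oneCentre : ∀ {q a b} → 2 ≤ suc r → suc r < q → 1 ≤ t → 1 ≤ a → 1 ≤ b →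
      t * ((suc r * (2 * t * b)) C suc r) < n → countLowCopies G 1 q a b * b ≤ a * n ^ q
    countLowCopies-oneCentre {q} {a} {b} 2≤s s<q 1≤t 1≤a 1≤b R<n = begin
      countLowCopies G 1 q a b * b                               ≡⟨ *-comm _ b ⟩
      b * countLowCopies G 1 q a b                               ≤⟨ *-monoʳ-≤ b (countLowStars≤ {q} {a} {b}) ⟩
      b * ∑[ u ∈ allFin n ] (𝟙 (lowDegᵇ a b u) * (deg G u C q))
        ≤⟨ lowDeg-∑C≤ (allFin n) (deg G) (∣p∣≤n ∘ nbhd) 2≤s s<q 1≤t 1≤a (∑-degCs≤ free) (∑-deg-highDeg≤ 1≤M R<n) ⟩
      a * n ^ q                                                  ∎
      where
      open ≤-Reasoning
      1≤M : 1 ≤ 2 * t * b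
      1≤M = *-mono-≤ (*-mono-≤ {1} {2} (s≤s z≤n) 1≤t) 1≤b

lemma2p3 : (p q s t : ℕ) → 1 ≤ p → 1 ≤ q → 1 ≤ s → 1 ≤ t →
    p < s → s ≤ t → s < q →
    -- ε = a / b > 0
    (a b : ℕ) → 1 ≤ a → 1 ≤ b →
    ∃ λ N → ∀ n → N ≤ n → (G : Graph n) → KstFree G s t →
      countLowCopies G p q a b * b ≤ a * n ^ (p + q ∸ 1)
lemma2p3 zero          _ _       _ () _ _ _ _ _ _ _ _ _ _
lemma2p3 (suc zero)    _ zero    _ _  _ _ _ () _ _ _ _ _ _
lemma2p3 (suc zero)    q (suc r) t _  _ _ 1≤t 2≤s _ s<q a b 1≤a 1≤b =
  suc (t * ((suc r * (2 * t * b)) C suc r)) ,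
  λ n R<n G free → countLowCopies-oneCentre G free 2≤s s<q 1≤t 1≤a 1≤b R<n
lemma2p3 (suc (suc p)) q s       t _  _ _ _ _ _ s<q a b 1≤a _ =
  suc (t ^ suc (suc p) * b) ,
  λ n tᵖb<n G free → countLowCopies-manyCentres G free (<⇒≤ s<q) 1≤a tᵖb<n
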